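{- Let $\equiv$ be the relation on $\mathrm{Form}$ defined by $\alpha\equiv\beta$ iff both $\alpha\to\beta$ and $\beta\to\alpha$ are provable in $\mathcal{L}_\delta$. Then (a) $\equiv$ is a congruence on the $\{\delta,\oplus,\neg,0\}$-algebra $\mathrm{Form}$; and (b) the quotient $\mathrm{Form}/{\equiv}$ is a $\delta$-algebra.
   Context: Fix a countably infinite set $\mathbf{Var}$ of propositional variables. The set $\mathrm{Form}$ of formulas is the least set containing $\mathbf{Var}$, closed under $\alpha,\beta\mapsto\alpha\to\beta$ and $\alpha\mapsto\neg\alpha$, and such that for every countably infinite sequence $\langle\alpha_i\rangle=\alpha_1,\alpha_2,\ldots$ of formulas, $\delta(\langle\alpha_i\rangle)$ is a formula. $\mathrm{Form}$ is regarded as an algebra in the language $\{\delta,\oplus,\neg,0\}$ of type $(\omega,2,1,0)$ via $\alpha\oplus\beta:=\neg\alpha\to\beta$, $\delta(\vec\gamma):=\delta(\langle\gamma_i\rangle)$, the obvious $\neg$, and $0:=\neg(\alpha\to\alpha)$ for a fixed arbitrary formula $\alpha$. Notation: $\langle\alpha\rangle$ is the constant sequence of value $\alpha$; $\alpha,\langle\beta_i\rangle$ is the sequence $\alpha,\beta_1,\beta_2,\ldots$; $\langle\alpha_i\rangle_{i>1}$ is $\alpha_2,\alpha_3,\ldots$; $\tfrac12\alpha:=\delta(\alpha,\langle\neg(\alpha\to\alpha)\rangle)$; an axiom $\alpha\leftrightarrow\beta$ means both $\alpha\to\beta$ and $\beta\to\alpha$ are axioms. The logic $\mathcal{L}_\delta$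 has as axioms all instances (for arbitrary formulas $\alpha,\beta,\gamma,\alpha_i,\beta_i$) of: (Ł1) $\alpha\to(\beta\to\alpha)$; (Ł2) $(\alpha\to\beta)\to((\beta\to\gamma)\to(\alpha\to\gamma))$; (Ł3) $((\alpha\to\beta)\to\beta)\to((\beta\to\alpha)\to\alpha)$; (Ł4) $(\neg\alpha\to\neg\beta)\to(\beta\to\alpha)$; (Δ1) $\neg(\delta(\langle\alpha_i\rangle)\to\tfrac12\alpha_1)\leftrightarrow\tfrac12\delta(\langle\alpha_i\rangle_{i>1})$; (Δ2) $\tfrac12\delta(\langle\alpha_i\rangle)\leftrightarrow\delta(\langle\tfrac12\alpha_i\rangle)$; (Δ3) $\delta(\langle\alpha\rangle)\leftrightarrow\alpha$; (Δ4) $\tfrac12\delta(\langle\alpha_i\rangle)\leftrightarrow\delta(\neg(\alpha\to\alpha),\langle\alpha_i\rangle)$; (Δ5) $\delta(\langle\alpha_i\rangle)\to\delta(\langle\neg\alpha_i\to\beta_i\rangle)$; (Δ6) $\tfrac12\neg(\alpha\to\beta)\leftrightarrow\neg(\tfrac12\alpha\to\tfrac12\beta)$; (Δ7) $\delta(\langle\alpha_i\to\beta_i\rangle)\to(\delta(\langle\alpha_i\rangle)\to\delta(\langle\beta_i\rangle))$. Rules: Modus Ponens (from $\alpha$ and $\alpha\to\beta$ infer $\beta$) and the $\delta$-rule (from $\alpha_i$ for all $i\in\omega$ infer $\delta(\langle\alpha_i\rangle)$). A proof of $\alpha$ from a set $\Theta$ is a sequence $(\alpha_i)_{i\in\eta+1}$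 of formulas indexed by a successor ordinal $\eta+1$ with $\eta$ countable, $\alpha_\eta=\alpha$, each member being an axiom, an element of $\Theta$, or obtained from earlier members by one of the rules; $\alpha$ is provable if it has a proof from $\emptyset$. An MV-algebra is an algebra $(A,\oplus,\neg,0)$ with $(A,\oplus,0)$ a commutative monoid, $\neg\neg a=a$, $a\oplus\neg0=\neg0$, $\neg(\neg a\oplus b)\oplus b=\neg(\neg b\oplus a)\oplus a$; write $a\odot b=\neg(\neg a\oplus\neg b)$, $a\ominus b=a\odot\neg b$, $a\vee b=\neg(\neg a\oplus b)\oplus b$, $d(a,b)=(a\ominus b)\oplus(b\ominus a)$, $a\le b$ iff $a\vee b=b$. A $\delta$-algebra is a $\{\delta,\oplus,\neg,0\}$-algebra whose $\{\oplus,\neg,0\}$-reduct is an MV-algebra and which satisfies, with $\tfrac12(x)=\delta(x,0,0,\ldots)$: (i) $d(\delta(\vec x),\delta(x_1,0,0,\ldots))=\delta(0,x_2,x_3,\ldots)$; (ii) $\tfrac12(\delta(\vec x))=\delta(\tfrac12(x_1),\tfrac12(x_2),\ldots)$; (iii) $\delta(x,x,\ldots)=x$; (iv) $\delta(0,x_1,x_2,\ldots)=\tfrac12(\delta(\vec x))$; (v) $\delta(x_1,x_2,\ldots)\le\delta(x_1\oplus y_1,x_2\oplus y_2,\ldots)$; (vi) $\tfrac12(x\ominus y)=\tfrac12(x)\ominus\tfrac12(y)$. -}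

module Defs where

open import Data.Nat using (ℕ; zero; suc)
open import Data.Product using (_×_)
open import Relation.Binary.Core using (Rel)
open import Relation.Binary.Structures using (IsEquivalence)
open import Algebra.Structures using (IsCommutativeMonoid)
open import Level using (Level; _⊔_)

infixr 5 _⇒_
infix 7 ~_

data Form : Set where
  var : ℕ → Form
  _⇒_ : Form → Form → Form
  ~_  : Form → Form
  δ   : (ℕ → Form) → Form

-- Countably infinite sequences α₁, α₂, … (index 0 stands for α₁)
Seq : Set
Seq = ℕ → Form

const : Form → Seq
const α _ = α

cons : Form → Seq → Seq
cons α βs zero    = α
cons α βs (suc i) = βs i

tail : Seq → Seq
tail αs i = αs (suc i)

bot : Form → Form
bot α = ~ (α ⇒ α)

half : Form → Form
half α = δ (cons α (const (bot α)))

-- Axioms of 𝓛_δ  (an axiom α ↔ β contributes both α → β and β → α)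

data Axiom : Form → Set where
  Ł1  : ∀ α β → Axiom (α ⇒ (β ⇒ α))
  Ł2  : ∀ α β γ → Axiom ((α ⇒ β) ⇒ ((β ⇒ γ) ⇒ (α ⇒ γ)))
  Ł3  : ∀ α β → Axiom (((α ⇒ β) ⇒ β) ⇒ ((β ⇒ α) ⇒ α))
  Ł4  : ∀ α β → Axiom ((~ α ⇒ ~ β) ⇒ (β ⇒ α))
  Δ1→ : ∀ (αs : Seq) → Axiom (~ (δ αs ⇒ half (αs 0)) ⇒ half (δ (tail αs)))
  Δ1← : ∀ (αs : Seq) → Axiom (half (δ (tail αs)) ⇒ ~ (δ αs ⇒ half (αs 0)))
  Δ2→ : ∀ (αs : Seq) → Axiom (half (δ αs) ⇒ δ (λ (i : ℕ) → half (αs i)))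
  Δ2← : ∀ (αs : Seq) → Axiom (δ (λ (i : ℕ) → half (αs i)) ⇒ half (δ αs))
  Δ3→ : ∀ α → Axiom (δ (const α) ⇒ α)
  Δ3← : ∀ α → Axiom (α ⇒ δ (const α))
  Δ4→ : ∀ α (αs : Seq) → Axiom (half (δ αs) ⇒ δ (cons (bot α) αs))
  Δ4← : ∀ α (αs : Seq) → Axiom (δ (cons (bot α) αs) ⇒ half (δ αs))
  Δ5  : ∀ (αs βs : Seq) → Axiom (δ αs ⇒ δ (λ (i : ℕ) → ~ (αs i) ⇒ βs i))
  Δ6→ : ∀ α β → Axiom (half (~ (α ⇒ β)) ⇒ ~ (half α ⇒ half β))
  Δ6← : ∀ α β → Axiom (~ (half α ⇒ half β) ⇒ half (~ (α ⇒ β)))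
  Δ7  : ∀ (αs βs : Seq) → Axiom (δ (λ (i : ℕ) → αs i ⇒ βs i) ⇒ (δ αs ⇒ δ βs))

data ⊢_ : Form → Set where
  ax : ∀ {φ} → Axiom φ → ⊢ φ
  mp : ∀ {α β} → ⊢ α → ⊢ (α ⇒ β) → ⊢ β
  δr : (αs : Seq) → ((i : ℕ) → ⊢ αs i) → ⊢ δ αs

_≣_ : Form → Form → Set
α ≣ β = (⊢ (α ⇒ β)) × (⊢ (β ⇒ α))

_⊕F_ : Form → Form → Form
α ⊕F β = ~ α ⇒ β

0F : Form
0F = bot (var 0)

record IsCongruence {a ℓ} {A : Set a} (_≈_ : Rel A ℓ)
         (dl : (ℕ → A) → A) (_⊕_ : A → A → A) (neg : A → A) (z : A)
         : Set (a ⊔ ℓ) where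
  field
    isEquivalence : IsEquivalence _≈_
    ⊕-cong : ∀ {x y u v} → x ≈ y → u ≈ v → (x ⊕ u) ≈ (y ⊕ v)
    neg-cong : ∀ {x y} → x ≈ y → neg x ≈ neg y
    δ-cong : ∀ {xs ys : ℕ → A} → (∀ i → xs i ≈ ys i) → dl xs ≈ dl ys

-- δ-algebras, with equality given by a relation _≈_ (so that a quotient
-- A/≈ is a δ-algebra iff these hold for the relation ≈ on A).

module DeltaOps {a} {A : Set a} (dl : (ℕ → A) → A) (_⊕_ : A → A → A)
                (neg : A → A) (z : A) where
  _⊙_ : A → A → A
  x ⊙ y = neg (neg x ⊕ neg y)
  _⊖_ : A → A → A
  x ⊖ y = x ⊙ neg y
  _∨_ : A → A → A
  x ∨ y = neg (neg x ⊕ y) ⊕ y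
  dist : A → A → A
  dist x y = (x ⊖ y) ⊕ (y ⊖ x)
  zs : ℕ → A
  zs _ = z
  ½ : A → A
  ½ x = dl (λ { zero → x ; (suc _) → z })
  consA : A → (ℕ → A) → ℕ → A
  consA x xs zero = x
  consA x xs (suc i) = xs i

record IsDeltaAlgebra {a ℓ} {A : Set a} (_≈_ : Rel A ℓ)
         (dl : (ℕ → A) → A) (_⊕_ : A → A → A) (neg : A → A) (z : A)
         : Set (a ⊔ ℓ) where
  open DeltaOps dl _⊕_ neg z
  _≤_ : A → A → Set ℓ
  x ≤ y = (x ∨ y) ≈ y
  field
    isCommutativeMonoid : IsCommutativeMonoid _≈_ _⊕_ z
    neg-invol : ∀ x → neg (neg x) ≈ x
    absorb    : ∀ x → (x ⊕ neg z) ≈ neg z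
    łuk       : ∀ x y → (neg (neg x ⊕ y) ⊕ y) ≈ (neg (neg y ⊕ x) ⊕ x)
    ax-i   : ∀ (xs : ℕ → A) →
             dist (dl xs) (dl (consA (xs 0) zs)) ≈ dl (consA z (λ i → xs (suc i)))
    ax-ii  : ∀ (xs : ℕ → A) → ½ (dl xs) ≈ dl (λ i → ½ (xs i))
    ax-iii : ∀ x → dl (λ _ → x) ≈ x
    ax-iv  : ∀ (xs : ℕ → A) → dl (consA z xs) ≈ ½ (dl xs)
    ax-v   : ∀ (xs ys : ℕ → A) → dl xs ≤ dl (λ i → xs i ⊕ ys i)
    ax-vi  : ∀ x y → ½ (x ⊖ y) ≈ (½ x ⊖ ½ y)

-- The Łukasiewicz axioms make
-- ≣ an equivalence compatible with ⇒ and ~, and under α ⊕ β = ~ α ⇒ β they turn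
-- into the MV-algebra laws; compatibility with δ is the δ-rule fed into Δ7.
-- Once every ¬(α → α) is identified with 0, so that the logic's ½α becomes the
-- algebra's ½(α), each δ-algebra axiom (i)–(vi) is the axiom Δ1–Δ6 of the same
-- shape read modulo ≣ (for (i), Δ5 shows that the second half of the distance
-- vanishes).
module Submission where

open import Data.Nat using (zero; suc)
open import Data.Product using (_×_; _,_; proj₁; proj₂)
open import Relation.Binary.Bundles using (Setoid)
open import Relation.Binary.Structures using (IsEquivalence)
open import Algebra.Structures using (IsCommutativeMonoid)

open import Defs

⇒-trans : ∀ {α β γ} → ⊢ (α ⇒ β) → ⊢ (β ⇒ γ) → ⊢ (α ⇒ γ)
⇒-trans {α} {β} {γ} p q = mp q (mp p (ax (Ł2 α β γ)))

⇒-weaken : ∀ {α} β → ⊢ α → ⊢ (β ⇒ α)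
⇒-weaken β p = mp p (ax (Ł1 _ β))

⇒-discharge : ∀ {τ} α → ⊢ τ → ⊢ ((τ ⇒ α) ⇒ α)
⇒-discharge α p = mp (⇒-weaken (α ⇒ _) p) (ax (Ł3 α _))

⇒-refl : ∀ α → ⊢ (α ⇒ α)
⇒-refl α = ⇒-trans (ax (Ł1 α τ)) (⇒-discharge α (ax (Ł1 (var 0) (var 0))))
  where τ = var 0 ⇒ (var 0 ⇒ var 0)

⊤F : Form
⊤F = var 0 ⇒ var 0

⊢⊤F : ⊢ ⊤F
⊢⊤F = ⇒-refl (var 0)

assertion : ∀ α β → ⊢ (α ⇒ ((α ⇒ β) ⇒ β))
assertion α β = ⇒-trans (ax (Ł1 α (β ⇒ α))) (ax (Ł3 β α))

exchange : ∀ α β γ → ⊢ ((α ⇒ (β ⇒ γ)) ⇒ (β ⇒ (α ⇒ γ)))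
exchange α β γ =
  ⇒-trans (ax (Ł2 α (β ⇒ γ) γ))
          (mp (assertion β γ) (ax (Ł2 β ((β ⇒ γ) ⇒ γ) (α ⇒ γ))))

⇒-mono : ∀ {α α′ β β′} → ⊢ (α′ ⇒ α) → ⊢ (β ⇒ β′) → ⊢ ((α ⇒ β) ⇒ (α′ ⇒ β′))
⇒-mono {α} {α′} {β} {β′} p q =
  ⇒-trans (mp p (ax (Ł2 α′ α β)))
          (mp q (mp (ax (Ł2 α′ β β′)) (exchange _ _ _)))

~~-elim : ∀ α → ⊢ (~ ~ α ⇒ α)
~~-elim α =
  ⇒-trans (ax (Ł1 (~ ~ α) (~ ~ ⊤F)))
  (⇒-trans (ax (Ł4 (~ ⊤F) (~ α)))
  (⇒-trans (ax (Ł4 α ⊤F)) (⇒-discharge α ⊢⊤F)))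

~~-intro : ∀ α → ⊢ (α ⇒ ~ ~ α)
~~-intro α = mp (~~-elim (~ α)) (ax (Ł4 (~ ~ α) α))

contraposition : ∀ α β → ⊢ ((α ⇒ β) ⇒ (~ β ⇒ ~ α))
contraposition α β = ⇒-trans (⇒-mono (~~-elim α) (~~-intro β)) (ax (Ł4 (~ α) (~ β)))

≣-refl : ∀ {α} → α ≣ α
≣-refl {α} = ⇒-refl α , ⇒-refl α

≣-sym : ∀ {α β} → α ≣ β → β ≣ α
≣-sym (p , q) = q , p

≣-trans : ∀ {α β γ} → α ≣ β → β ≣ γ → α ≣ γ
≣-trans (p , q) (r , s) = ⇒-trans p r , ⇒-trans s q

≣-isEquivalence : IsEquivalence _≣_
≣-isEquivalence = record { refl = ≣-refl ; sym = ≣-sym ; trans = ≣-trans }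

≣-setoid : Setoid _ _
≣-setoid = record { isEquivalence = ≣-isEquivalence }

open import Relation.Binary.Reasoning.Setoid ≣-setoid

⇒-cong : ∀ {α α′ β β′} → α ≣ α′ → β ≣ β′ → (α ⇒ β) ≣ (α′ ⇒ β′)
⇒-cong (p , q) (r , s) = ⇒-mono q r , ⇒-mono p s

~-cong : ∀ {α β} → α ≣ β → (~ α) ≣ (~ β)
~-cong {α} {β} (p , q) = mp q (contraposition β α) , mp p (contraposition α β)

δ-cong : ∀ {αs βs : Seq} → (∀ i → αs i ≣ βs i) → δ αs ≣ δ βs
δ-cong {αs} {βs} e =
  mp (δr _ (λ i → proj₁ (e i))) (ax (Δ7 αs βs)) ,
  mp (δr _ (λ i → proj₂ (e i))) (ax (Δ7 βs αs))

⊕-cong : ∀ {α α′ β β′} → α ≣ α′ → β ≣ β′ → (α ⊕F β) ≣ (α′ ⊕F β′)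
⊕-cong e f = ⇒-cong (~-cong e) f

theorems-≣ : ∀ {α β} → ⊢ α → ⊢ β → α ≣ β
theorems-≣ {α} {β} p q = ⇒-weaken α q , ⇒-weaken β p

~~-≣ : ∀ α → (~ ~ α) ≣ α
~~-≣ α = ~~-elim α , ~~-intro α

contraposition-≣ : ∀ α β → (α ⇒ β) ≣ (~ β ⇒ ~ α)
contraposition-≣ α β = contraposition α β , ax (Ł4 β α)

exchange-≣ : ∀ α β γ → (α ⇒ (β ⇒ γ)) ≣ (β ⇒ (α ⇒ γ))
exchange-≣ α β γ = exchange α β γ , exchange β α γ

⇒-identityˡ : ∀ {τ} α → ⊢ τ → (τ ⇒ α) ≣ α
⇒-identityˡ {τ} α p = ⇒-discharge α p , ax (Ł1 α τ)

residuation : ∀ α β γ → (α ⇒ (β ⇒ γ)) ≣ (~ (α ⇒ ~ β) ⇒ γ)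
residuation α β γ = begin
  α ⇒ (β ⇒ γ)          ≈⟨ ⇒-cong ≣-refl (contraposition-≣ β γ) ⟩
  α ⇒ (~ γ ⇒ ~ β)      ≈⟨ exchange-≣ α (~ γ) (~ β) ⟩
  ~ γ ⇒ (α ⇒ ~ β)      ≈⟨ contraposition-≣ (~ γ) (α ⇒ ~ β) ⟩
  ~ (α ⇒ ~ β) ⇒ ~ ~ γ  ≈⟨ ⇒-cong ≣-refl (~~-≣ γ) ⟩
  ~ (α ⇒ ~ β) ⇒ γ      ∎

open DeltaOps δ _⊕F_ ~_ 0F

⊕-assoc : ∀ α β γ → ((α ⊕F β) ⊕F γ) ≣ (α ⊕F (β ⊕F γ))
⊕-assoc α β γ = begin
  ~ (~ α ⇒ β) ⇒ γ      ≈⟨ ⇒-cong (~-cong (⇒-cong ≣-refl (~~-≣ β))) ≣-refl ⟨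
  ~ (~ α ⇒ ~ ~ β) ⇒ γ  ≈⟨ residuation (~ α) (~ β) γ ⟨
  ~ α ⇒ (~ β ⇒ γ)      ∎

⊕-identityˡ : ∀ α → (0F ⊕F α) ≣ α
⊕-identityˡ α = ≣-trans (⇒-cong (~~-≣ ⊤F) ≣-refl) (⇒-identityˡ α ⊢⊤F)

⊕-identityʳ : ∀ α → (α ⊕F 0F) ≣ α
⊕-identityʳ α = ≣-trans (≣-sym (contraposition-≣ ⊤F α)) (⇒-identityˡ α ⊢⊤F)

⊕-comm : ∀ α β → (α ⊕F β) ≣ (β ⊕F α)
⊕-comm α β = ≣-trans (contraposition-≣ (~ α) β) (⇒-cong ≣-refl (~~-≣ α))

⊕-zeroʳ : ∀ α → (α ⊕F (~ 0F)) ≣ (~ 0F)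
⊕-zeroʳ α = theorems-≣ (⇒-weaken (~ α) ⊢~0F) ⊢~0F
  where ⊢~0F = mp ⊢⊤F (~~-intro ⊤F)

∨-≣ : ∀ α β → (α ∨ β) ≣ ((α ⇒ β) ⇒ β)
∨-≣ α β = ⇒-cong (≣-trans (~~-≣ _) (⇒-cong (~~-≣ α) ≣-refl)) ≣-refl

∨-comm : ∀ α β → (α ∨ β) ≣ (β ∨ α)
∨-comm α β = ≣-trans (∨-≣ α β) (≣-trans (ax (Ł3 α β) , ax (Ł3 β α)) (≣-sym (∨-≣ β α)))

∨-absorbs-⊢ : ∀ {α β} → ⊢ (α ⇒ β) → (α ∨ β) ≣ β
∨-absorbs-⊢ {α} {β} p = ≣-trans (∨-≣ α β) (⇒-identityˡ β p)

⊖-≣ : ∀ α β → (α ⊖ β) ≣ (~ (α ⇒ β))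
⊖-≣ α β = ~-cong (⇒-cong (~~-≣ α) (~~-≣ β))

⊖-vanishes-⊢ : ∀ {α β} → ⊢ (α ⇒ β) → (α ⊖ β) ≣ 0F
⊖-vanishes-⊢ {α} {β} p = ≣-trans (⊖-≣ α β) (~-cong (theorems-≣ p ⊢⊤F))

bot-≣-0F : ∀ α → bot α ≣ 0F
bot-≣-0F α = ~-cong (theorems-≣ (⇒-refl α) ⊢⊤F)

half-≣-½ : ∀ α → half α ≣ ½ α
half-≣-½ α = δ-cong λ { zero → ≣-refl ; (suc _) → bot-≣-0F α }

cons-≣-consA : ∀ α αs i → cons α αs i ≣ consA α αs i
cons-≣-consA α αs zero    = ≣-refl
cons-≣-consA α αs (suc i) = ≣-refl

½-cong : ∀ {α β} → α ≣ β → ½ α ≣ ½ β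
½-cong e = δ-cong λ { zero → e ; (suc _) → ≣-refl }

δ-head-≣-half : ∀ (αs : Seq) → δ (consA (αs 0) zs) ≣ half (αs 0)
δ-head-≣-half αs = δ-cong λ { zero → ≣-refl ; (suc _) → ≣-sym (bot-≣-0F (αs 0)) }

δ-⊖-head : ∀ (αs : Seq) → (δ αs ⊖ δ (consA (αs 0) zs)) ≣ δ (consA 0F (tail αs))
δ-⊖-head αs = begin
  δ αs ⊖ δ (consA (αs 0) zs)       ≈⟨ ⊖-≣ _ _ ⟩
  ~ (δ αs ⇒ δ (consA (αs 0) zs))   ≈⟨ ~-cong (⇒-cong ≣-refl (δ-head-≣-half αs)) ⟩
  ~ (δ αs ⇒ half (αs 0))           ≈⟨ ax (Δ1→ αs) , ax (Δ1← αs) ⟩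
  half (δ (tail αs))               ≈⟨ ax (Δ4→ (var 0) (tail αs)) , ax (Δ4← (var 0) (tail αs)) ⟩
  δ (cons 0F (tail αs))            ≈⟨ δ-cong (cons-≣-consA 0F (tail αs)) ⟩
  δ (consA 0F (tail αs))           ∎

δ-head-⊢ : ∀ (αs : Seq) → ⊢ (δ (consA (αs 0) zs) ⇒ δ αs)
δ-head-⊢ αs = ⇒-trans (ax (Δ5 (consA (αs 0) zs) (consA 0F (tail αs)))) (proj₁ (δ-cong pad))
  where
  pad : ∀ i → (consA (αs 0) zs i ⊕F consA 0F (tail αs) i) ≣ αs i
  pad zero    = ⊕-identityʳ (αs 0)
  pad (suc i) = ⊕-identityˡ (αs (suc i))

δ-dist-head : ∀ (αs : Seq) → dist (δ αs) (δ (consA (αs 0) zs)) ≣ δ (consA 0F (tail αs))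
δ-dist-head αs =
  ≣-trans (⊕-cong (δ-⊖-head αs) (⊖-vanishes-⊢ (δ-head-⊢ αs))) (⊕-identityʳ _)

½-distrib-δ : ∀ (αs : Seq) → ½ (δ αs) ≣ δ (λ i → ½ (αs i))
½-distrib-δ αs = begin
  ½ (δ αs)              ≈⟨ half-≣-½ (δ αs) ⟨
  half (δ αs)           ≈⟨ ax (Δ2→ αs) , ax (Δ2← αs) ⟩
  δ (λ i → half (αs i)) ≈⟨ δ-cong (λ i → half-≣-½ (αs i)) ⟩
  δ (λ i → ½ (αs i))    ∎

δ-const : ∀ α → δ (λ _ → α) ≣ α
δ-const α = ax (Δ3→ α) , ax (Δ3← α)

δ-shift : ∀ (αs : Seq) → δ (consA 0F αs) ≣ ½ (δ αs)
δ-shift αs = begin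
  δ (consA 0F αs) ≈⟨ δ-cong (cons-≣-consA 0F αs) ⟨
  δ (cons 0F αs)  ≈⟨ ax (Δ4← (var 0) αs) , ax (Δ4→ (var 0) αs) ⟩
  half (δ αs)     ≈⟨ half-≣-½ (δ αs) ⟩
  ½ (δ αs)        ∎

δ-mono-⊕ : ∀ (αs βs : Seq) → (δ αs ∨ δ (λ i → αs i ⊕F βs i)) ≣ δ (λ i → αs i ⊕F βs i)
δ-mono-⊕ αs βs = ∨-absorbs-⊢ (ax (Δ5 αs βs))

½-distrib-⊖ : ∀ α β → ½ (α ⊖ β) ≣ (½ α ⊖ ½ β)
½-distrib-⊖ α β = begin
  ½ (α ⊖ β)              ≈⟨ ½-cong (⊖-≣ α β) ⟩
  ½ (~ (α ⇒ β))          ≈⟨ half-≣-½ _ ⟨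
  half (~ (α ⇒ β))       ≈⟨ ax (Δ6→ α β) , ax (Δ6← α β) ⟩
  ~ (half α ⇒ half β)    ≈⟨ ~-cong (⇒-cong (half-≣-½ α) (half-≣-½ β)) ⟩
  ~ (½ α ⇒ ½ β)          ≈⟨ ⊖-≣ (½ α) (½ β) ⟨
  ½ α ⊖ ½ β              ∎

≣-isCongruence : IsCongruence _≣_ δ _⊕F_ ~_ 0F
≣-isCongruence = record
  { isEquivalence = ≣-isEquivalence
  ; ⊕-cong        = ⊕-cong
  ; neg-cong      = ~-cong
  ; δ-cong        = δ-cong
  }

⊕-isCommutativeMonoid : IsCommutativeMonoid _≣_ _⊕F_ 0F
⊕-isCommutativeMonoid = record
  { isMonoid = record
    { isSemigroup = record
      { isMagma = record { isEquivalence = ≣-isEquivalence ; ∙-cong = ⊕-cong }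
      ; assoc   = ⊕-assoc
      }
    ; identity = ⊕-identityˡ , ⊕-identityʳ
    }
  ; comm = ⊕-comm
  }

≣-isDeltaAlgebra : IsDeltaAlgebra _≣_ δ _⊕F_ ~_ 0F
≣-isDeltaAlgebra = record
  { isCommutativeMonoid = ⊕-isCommutativeMonoid
  ; neg-invol           = ~~-≣
  ; absorb              = ⊕-zeroʳ
  ; łuk                 = ∨-comm
  ; ax-i                = δ-dist-head
  ; ax-ii               = ½-distrib-δ
  ; ax-iii              = δ-const
  ; ax-iv               = δ-shift
  ; ax-v                = δ-mono-⊕
  ; ax-vi               = ½-distrib-⊖
  }

proposition5p2 : IsCongruence _≣_ δ _⊕F_ ~_ 0F × IsDeltaAlgebra _≣_ δ _⊕F_ ~_ 0F
proposition5p2 = ≣-isCongruence , ≣-isDeltaAlgebra
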